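{- Let $a,b\geq 2$ be integers and write $a+b=tb^2+\epsilon$ with integers $t\ge 0$ and $0\le\epsilon\le b^2-1$. Then there is a unique smooth arithmetical structure on $D_n$ with $\bar r_x=a$ and $\bar r_y=b$ if $n=F(b^2,\epsilon)+t+\left\lfloor \frac{ab}{a+b}\right\rfloor$, and there is no such structure on $D_n$ for any other $n$.
   Context: For $n\ge 3$ let $\ell=n-3$. The bident $D_n$ has vertices $v_x,v_y,v_0,\dots,v_\ell$ and edges $v_xv_0$, $v_yv_0$, $v_iv_{i+1}$ ($0\le i\le\ell-1$). An arithmetical structure on $D_n$ is a pair $(\mathbf d,\mathbf r)$, $\mathbf d=(d_x,d_y,d_0,\dots,d_\ell)$, $\mathbf r=(r_x,r_y,r_0,\dots,r_\ell)$, of positive integer vectors with $(\operatorname{diag}(\mathbf d)-A)\mathbf r=\mathbf 0$ ($A$ the adjacency matrix) and $\mathbf r$ primitive. It is smooth if $d_x,d_y,d_1,\dots,d_\ell\ge2$. For such a structure set $\bar{\mathbf r}=\frac{r_0}{r_xr_y}\mathbf r$ (an integer vector with $\bar r_x\bar r_y=\bar r_0$). The function $F:\mathbb Z_{>0}\times\mathbb Z_{\ge0}\to\mathbb Z_{>0}$ is defined as follows: given $x_1>0$, $x_2\ge0$, for each $i\ge 2$ with $x_i>0$ let $x_{i+1}$ be the least nonnegative residue of $-x_{i-1}$ modulo $x_i$; $F(x_1,x_2)$ is the number of positive terms of $(x_i)$ (so $F(x,0)=1$). -}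

module Defs where

open import Data.Nat using (ℕ; zero; suc; _+_; _*_; _∸_; _≤_; _<_; _%_; _≡ᵇ_)
open import Data.Nat.Divisibility using (_∣_)
open import Data.Bool using (Bool; true; false; _∨_; if_then_else_)
open import Data.Fin using (Fin; toℕ)
open import Data.Vec using (Vec; []; _∷_; lookup; tabulate; sum)
open import Data.Product using (_×_)
open import Relation.Binary.PropositionalEquality using (_≡_; _≢_)

-- Vertex numbering of the bident D_n on Fin n:
--   index 0 ↦ v_x, index 1 ↦ v_y, index k+2 ↦ v_k  (0 ≤ k ≤ ℓ = n-3).
-- Edges: v_x v_0, v_y v_0, v_k v_{k+1}.
bidentEdge : ℕ → ℕ → Bool
bidentEdge 0 2 = true
bidentEdge 2 0 = true
bidentEdge 1 2 = true
bidentEdge 2 1 = true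
bidentEdge (suc (suc i)) (suc (suc j)) = (suc i ≡ᵇ j) ∨ (suc j ≡ᵇ i)
bidentEdge _ _ = false

bidentAdj : {n : ℕ} → Fin n → Fin n → ℕ
bidentAdj i j = if bidentEdge (toℕ i) (toℕ j) then 1 else 0

-- lookup by a natural-number index (0 outside the range; only used with n ≥ 3)
at : {n : ℕ} → Vec ℕ n → ℕ → ℕ
at [] _ = 0
at (x ∷ v) zero = x
at (x ∷ v) (suc k) = at v k

record IsArithStructure (n : ℕ) (d r : Vec ℕ n) : Set where
  field
    d-pos     : ∀ i → 0 < lookup d i
    r-pos     : ∀ i → 0 < lookup r i
    laplacian : ∀ i → lookup d i * lookup r i
                        ≡ sum (tabulate (λ j → bidentAdj i j * lookup r j))
    r-primitive : ∀ g → (∀ i → g ∣ lookup r i) → g ≡ 1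

IsSmooth : (n : ℕ) → Vec ℕ n → Set
IsSmooth n d = ∀ i → toℕ i ≢ 2 → 2 ≤ lookup d i

-- r̄ = (r_0 / (r_x r_y)) r.  Since r_x r_y > 0, the equation r̄_v = c is
-- equivalent to r_0 * r_v = c * (r_x * r_y); we state it in that form.
RbarAt : {n : ℕ} → Vec ℕ n → ℕ → ℕ → Set
RbarAt r v c = at r 2 * at r v ≡ c * (at r 0 * at r 1)

SmoothStructWith : (n : ℕ) → ℕ → ℕ → Vec ℕ n → Vec ℕ n → Set
SmoothStructWith n a b d r =
  IsArithStructure n d r × IsSmooth n d × RbarAt r 0 a × RbarAt r 1 b

-- Fcount fuel p q counts the positive terms of the
-- sequence q, (-p mod q), ... (x_{i+1} = least nonneg residue of -x_{i-1} mod x_i).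
-- The terms from x_2 on are strictly decreasing, so fuel q+1 suffices.
Fcount : ℕ → ℕ → ℕ → ℕ
Fcount zero p q = 0
Fcount (suc fuel) p zero = 0
Fcount (suc fuel) p (suc q') = 1 + Fcount fuel (suc q') ((suc q' ∸ (p % suc q')) % suc q')

F : ℕ → ℕ → ℕ
F x₁ x₂ = 1 + Fcount (suc x₂) x₁ x₂

-- Merging the two prongs, the Laplacian equations along the stem r_x + r_y, r_0, r_1, …, r_ℓ, 0
-- read d_k r_k = r_(k-1) + r_(k+1).  Smoothness (d_k ≥ 2) makes the stem strictly decreasing, so
-- each term is the least nonnegative residue of minus the term two steps back modulo the previous
-- one.  As r̄_x = a and r̄_y = b mean r_0 = b r_x = a r_y, the stem is r_0/(ab) times the residue
-- sequence of (a + b, ab): r is determined up to scale, hence by primitivity, and a structure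
-- exists exactly when that sequence has ℓ + 1 positive terms after a + b (divide it by its gcd and
-- take d_k = ⌈r_(k-1)/r_k⌉).  Counting positive terms is Euclidean: reducing the second entry by
-- the first removes exactly one term, so writing a + b = t b² + ε and ab = q (a + b) + ρ turns the
-- count into F(b², ε) + t + q − 2.

module Submission where

open import Defs
open import Data.Nat
open import Data.Nat.Properties
open import Data.Nat.DivMod using (%-distribˡ-+; m%n%n≡m%n; m%n≤n; m%n<n; n%n≡0; m/n*n≡m)
open import Data.Nat.Divisibility
open import Data.Nat.GCD using (gcd; gcd[m,n]∣m; gcd[m,n]∣n; gcd[m,n]≢0; gcd-greatest)
open import Data.Nat.Coprimality using (coprime-/gcd; coprime-divisor)
import Data.Nat.Coprimality as Coprime
open import Data.Nat.Induction using (<-rec)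
open import Algebra.Properties.CommutativeSemigroup +-commutativeSemigroup
  using () renaming (x∙yz≈y∙xz to m+[n+o]≡n+[m+o]; xy∙z≈xz∙y to m+n+o≡m+o+n; xy∙z≈y∙zx to m+n+o≡n+[o+m];
                     interchange to [m+n]+[o+p]≡[m+o]+[n+p])
open import Algebra.Properties.CommutativeSemigroup *-commutativeSemigroup
  using () renaming (x∙yz≈y∙xz to m*[n*o]≡n*[m*o]; x∙yz≈xz∙y to m*[n*o]≡m*o*n; xy∙z≈xz∙y to m*n*o≡m*o*n;
                     xy∙z≈y∙xz to m*n*o≡n*[m*o])
open import Data.Bool using (if_then_else_; _∨_)
open import Data.Fin using (Fin; toℕ; fromℕ<)
open import Data.Fin.Properties using (toℕ<n; toℕ-fromℕ<)
open import Data.Vec using (Vec; []; _∷_; lookup; tabulate; sum)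
open import Data.Vec.Properties using (lookup∘tabulate; tabulate∘lookup; tabulate-cong)
open import Data.Product using (Σ; _×_; _,_; proj₁; proj₂)
open import Data.Sum using (inj₁; inj₂)
open import Data.Empty using (⊥-elim)
open import Relation.Nullary using (¬_; yes; no)
open import Relation.Binary.PropositionalEquality

*-positive : ∀ {m n} → 0 < m → 0 < n → 0 < m * n
*-positive {suc _} {suc _} _ _ = z<s

positive-factorʳ : ∀ m {n} → 0 < m * n → 0 < n
positive-factorʳ m {zero} 0<m*0 = ⊥-elim (n≮0 (subst (0 <_) (*-zeroʳ m) 0<m*0))
positive-factorʳ m {suc _} _ = z<s

-- The step of Fcount, written identically so that the two agree definitionally; negMod x 0 = 0.
negMod : ℕ → ℕ → ℕ
negMod x zero = 0
negMod x (suc m) = (suc m ∸ x % suc m) % suc m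

negMod-< : ∀ x {m} → 0 < m → negMod x m < m
negMod-< x {suc m} _ = m%n<n (suc m ∸ x % suc m) (suc m)

negMod-∣ : ∀ x {m} → 0 < m → m ∣ x + negMod x m
negMod-∣ x {m@(suc _)} _ = m%n≡0⇒n∣m (x + negMod x m) m (begin
  (x + negMod x m) % m                   ≡⟨ %-distribˡ-+ x (negMod x m) m ⟩
  (x % m + negMod x m % m) % m           ≡⟨ cong (λ z → (x % m + z) % m) (m%n%n≡m%n (m ∸ x % m) m) ⟩
  (x % m + (m ∸ x % m) % m) % m          ≡⟨ cong (λ z → (z + (m ∸ x % m) % m) % m) (sym (m%n%n≡m%n x m)) ⟩
  (x % m % m + (m ∸ x % m) % m) % m      ≡⟨ sym (%-distribˡ-+ (x % m) (m ∸ x % m) m) ⟩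
  (x % m + (m ∸ x % m)) % m              ≡⟨ cong (_% m) (m+[n∸m]≡n (m%n≤n x m)) ⟩
  m % m                                  ≡⟨ n%n≡0 m ⟩
  0                                      ∎)
  where open ≡-Reasoning

residue-unique-≤ : ∀ {m x z w} → z ≤ w → w < m → m ∣ x + z → m ∣ x + w → z ≡ w
residue-unique-≤ {m} {x} {z} {w} z≤w w<m m∣x+z m∣x+w with w ∸ z in eq
... | zero = ≤-antisym z≤w (m∸n≡0⇒m≤n eq)
... | suc k = ⊥-elim (<⇒≱ (≤-<-trans (subst (_≤ w) eq (m∸n≤m w z)) w<m) (∣⇒≤ (subst (m ∣_) eq m∣w∸z)))
  where
  m∣w∸z : m ∣ w ∸ z
  m∣w∸z = ∣m+n∣m⇒∣n (subst (m ∣_) x+w≡x+z+[w∸z] m∣x+w) m∣x+z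
    where
    x+w≡x+z+[w∸z] : x + w ≡ x + z + (w ∸ z)
    x+w≡x+z+[w∸z] = trans (cong (x +_) (sym (m+[n∸m]≡n z≤w))) (sym (+-assoc x z (w ∸ z)))

negMod-unique : ∀ x {m z} → z < m → m ∣ x + z → z ≡ negMod x m
negMod-unique x {m} {z} z<m m∣x+z with ≤-total z (negMod x m)
... | inj₁ z≤neg = residue-unique-≤ z≤neg (negMod-< x (m<n⇒0<n z<m)) m∣x+z (negMod-∣ x (m<n⇒0<n z<m))
... | inj₂ neg≤z = sym (residue-unique-≤ neg≤z z<m (negMod-∣ x (m<n⇒0<n z<m)) m∣x+z)

negMod-+ : ∀ x m → negMod (x + m) m ≡ negMod x m
negMod-+ x zero = refl
negMod-+ x m@(suc _) = sym (negMod-unique (x + m) (negMod-< x z<s)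
  (subst (m ∣_) (m+n+o≡m+o+n x (negMod x m) m) (∣m∣n⇒∣m+n (negMod-∣ x z<s) (∣-refl {m}))))

negMod-* : ∀ c x m → negMod (c * x) (c * m) ≡ c * negMod x m
negMod-* zero x m = refl
negMod-* c@(suc _) x zero rewrite *-zeroʳ c = refl
negMod-* c@(suc _) x m@(suc _) = sym (negMod-unique (c * x) (*-monoʳ-< c (negMod-< x z<s))
  (subst (c * m ∣_) (*-distribˡ-+ c x (negMod x m)) (*-monoʳ-∣ c (negMod-∣ x z<s))))

residues : ℕ → ℕ → ℕ → ℕ
residues p q zero = p
residues p q (suc k) = residues q (negMod p q) k

residues-suc-suc : ∀ p q k → residues p q (2 + k) ≡ negMod (residues p q k) (residues p q (suc k))
residues-suc-suc p q zero = refl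
residues-suc-suc p q (suc k) = residues-suc-suc q (negMod p q) k

residues-unique : (s : ℕ → ℕ) → (∀ k → s (2 + k) ≡ negMod (s k) (s (suc k))) →
  ∀ k → s k ≡ residues (s 0) (s 1) k
residues-unique s rec zero = refl
residues-unique s rec (suc k) = trans (residues-unique (λ j → s (suc j)) (λ j → rec (suc j)) k)
  (cong (λ z → residues (s 1) z k) (rec 0))

residues-* : ∀ c p q k → c * residues p q k ≡ residues (c * p) (c * q) k
residues-* c p q zero = refl
residues-* c p q (suc k) = trans (residues-* c q (negMod p q) k) (cong (λ z → residues (c * q) z k) (sym (negMod-* c p q)))

residues-< : ∀ p q k → 0 < residues p q (suc k) → residues p q (2 + k) < residues p q (suc k)
residues-< p q k pos rewrite residues-suc-suc p q k = negMod-< (residues p q k) pos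

residues-≡0 : ∀ p q {k j} → k ≤′ j → residues p q (suc k) ≡ 0 → residues p q (suc j) ≡ 0
residues-≡0 p q ≤′-refl vanish = vanish
residues-≡0 p q {j = suc j} (≤′-step k≤j) vanish
  rewrite residues-suc-suc p q j | residues-≡0 p q k≤j vanish = refl

positiveTerms : ℕ → ℕ → ℕ
positiveTerms p q = Fcount (suc q) p q

Fcount-fuel : ∀ f f' p q → q < f → q < f' → Fcount f p q ≡ Fcount f' p q
Fcount-fuel (suc f) (suc f') p zero _ _ = refl
Fcount-fuel (suc f) (suc f') p q@(suc _) (s≤s q<f) (s≤s q<f') =
  cong suc (Fcount-fuel f f' q (negMod p q) (≤-trans (negMod-< p z<s) q<f) (≤-trans (negMod-< p z<s) q<f'))

positiveTerms-step : ∀ p {q} → 0 < q → positiveTerms p q ≡ suc (positiveTerms q (negMod p q))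
positiveTerms-step p {q@(suc q')} _ =
  cong suc (Fcount-fuel (suc q') (suc (negMod p q)) q (negMod p q) (negMod-< p z<s) ≤-refl)

positiveTerms-+ˡ : ∀ p m → positiveTerms (p + m) m ≡ positiveTerms p m
positiveTerms-+ˡ p zero = refl
positiveTerms-+ˡ p m@(suc _) = begin
  positiveTerms (p + m) m                 ≡⟨ positiveTerms-step (p + m) z<s ⟩
  suc (positiveTerms m (negMod (p + m) m)) ≡⟨ cong (λ z → suc (positiveTerms m z)) (negMod-+ p m) ⟩
  suc (positiveTerms m (negMod p m))       ≡⟨ positiveTerms-step p z<s ⟨
  positiveTerms p m                        ∎
  where open ≡-Reasoning

positiveTerms-+ʳ : ∀ {p} m → 0 < p → positiveTerms p (p + m) ≡ suc (positiveTerms p m)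
positiveTerms-+ʳ {p} m p>0 = begin
  positiveTerms p (p + m)                  ≡⟨ positiveTerms-step p (<-≤-trans p>0 (m≤m+n p m)) ⟩
  suc (positiveTerms (p + m) (negMod p (p + m))) ≡⟨ cong (λ z → suc (positiveTerms (p + m) z)) negMod-p[p+m] ⟨
  suc (positiveTerms (p + m) m)            ≡⟨ cong suc (positiveTerms-+ˡ p m) ⟩
  suc (positiveTerms p m)                  ∎
  where
  open ≡-Reasoning
  negMod-p[p+m] : m ≡ negMod p (p + m)
  negMod-p[p+m] = negMod-unique p (m<n+m m p>0) ∣-refl

positiveTerms-+* : ∀ {p} r k → 0 < p → positiveTerms p (r + k * p) ≡ positiveTerms p r + k
positiveTerms-+* {p} r zero _ = trans (cong (positiveTerms p) (+-identityʳ r)) (sym (+-identityʳ _))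
positiveTerms-+* {p} r (suc k) p>0 = begin
  positiveTerms p (r + (p + k * p))  ≡⟨ cong (positiveTerms p) (m+[n+o]≡n+[m+o] r p (k * p)) ⟩
  positiveTerms p (p + (r + k * p))  ≡⟨ positiveTerms-+ʳ (r + k * p) p>0 ⟩
  suc (positiveTerms p (r + k * p))  ≡⟨ cong suc (positiveTerms-+* r k p>0) ⟩
  suc (positiveTerms p r + k)        ≡⟨ +-suc (positiveTerms p r) k ⟨
  positiveTerms p r + suc k          ∎
  where open ≡-Reasoning

HasPositiveTerms : ℕ → ℕ → ℕ → Set
HasPositiveTerms p q L = (∀ j → j < L → 0 < residues p q (suc j)) × residues p q (suc L) ≡ 0

positiveTerms-exact : ∀ L p q → HasPositiveTerms p q L → positiveTerms p q ≡ L
positiveTerms-exact zero p q (_ , q≡0) = cong (positiveTerms p) q≡0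
positiveTerms-exact (suc L) p q (pos , last) = trans (positiveTerms-step p (pos 0 z<s))
  (cong suc (positiveTerms-exact L q (negMod p q) ((λ j j<L → pos (suc j) (s<s j<L)) , last)))

hasPositiveTerms : ∀ q p → HasPositiveTerms p q (positiveTerms p q)
hasPositiveTerms = <-rec (λ q → ∀ p → HasPositiveTerms p q (positiveTerms p q)) count
  where
  count : ∀ q → (∀ {q'} → q' < q → ∀ p → HasPositiveTerms p q' (positiveTerms p q')) →
          ∀ p → HasPositiveTerms p q (positiveTerms p q)
  count zero _ p = (λ _ ()) , refl
  count q@(suc _) ih p with ih (negMod-< p z<s) q
  ... | pos , last = subst (HasPositiveTerms p q) (sym (positiveTerms-step p {q} z<s))
    ((λ { zero _ → z<s ; (suc j) (s<s j<G) → pos j j<G }) , last)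

-- Two Euclidean divisions, linked by b (a + b) = b² + ab, which makes negMod b² (a + b) = ρ.
F-bident : ∀ a b t ε q → 0 < b → a + b ≡ t * (b * b) + ε →
           q * (a + b) ≤ a * b → a * b < suc q * (a + b) →
           F (b * b) ε + t + q ≡ 2 + positiveTerms (a + b) (a * b)
F-bident a b@(suc _) t ε q _ a+b≡ q[a+b]≤ab ab<[1+q][a+b] = begin
  suc (positiveTerms B ε + t) + q            ≡⟨ cong (λ z → suc z + q) (positiveTerms-+* ε t z<s) ⟨
  suc (positiveTerms B (ε + t * B)) + q      ≡⟨ cong (λ z → suc (positiveTerms B z) + q)
                                                     (trans (+-comm ε (t * B)) (sym a+b≡)) ⟩
  suc (positiveTerms B A) + q                ≡⟨ cong (λ z → suc z + q) (positiveTerms-step B A>0) ⟩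
  2 + (positiveTerms A (negMod B A) + q)     ≡⟨ cong (λ z → 2 + (positiveTerms A z + q)) negMod-b²≡ρ ⟨
  2 + (positiveTerms A ρ + q)                ≡⟨ cong (2 +_) (positiveTerms-+* ρ q A>0) ⟨
  2 + positiveTerms A (ρ + q * A)            ≡⟨ cong (λ z → 2 + positiveTerms A z) ab≡ρ+qA ⟨
  2 + positiveTerms A (a * b)                ∎
  where
  open ≡-Reasoning
  A B ρ : ℕ
  A = a + b
  B = b * b
  ρ = a * b ∸ q * A
  A>0 : 0 < A
  A>0 = <-≤-trans z<s (m≤n+m b a)
  ab≡ρ+qA : a * b ≡ ρ + q * A
  ab≡ρ+qA = sym (m∸n+n≡m q[a+b]≤ab)
  ρ<A : ρ < A
  ρ<A = +-cancelʳ-< (q * A) ρ A (subst (_< suc q * A) ab≡ρ+qA ab<[1+q][a+b])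
  bA≡ : b * A ≡ q * A + (B + ρ)
  bA≡ = begin
    b * A              ≡⟨ *-distribˡ-+ b a b ⟩
    b * a + B          ≡⟨ cong (_+ B) (trans (*-comm b a) ab≡ρ+qA) ⟩
    ρ + q * A + B      ≡⟨ m+n+o≡n+[o+m] ρ (q * A) B ⟩
    q * A + (B + ρ)    ∎
  negMod-b²≡ρ : ρ ≡ negMod B A
  negMod-b²≡ρ = negMod-unique B ρ<A (∣m+n∣m⇒∣n (subst (A ∣_) bA≡ (n∣m*n b)) (n∣m*n q))

neighbourSum : (ℕ → ℕ) → ℕ → ℕ
neighbourSum r 0 = r 2
neighbourSum r 1 = r 2
neighbourSum r 2 = r 0 + r 1 + r 3
neighbourSum r (suc (suc (suc k))) = r (2 + k) + r (4 + k)

neighbourSum-cong : ∀ {f g : ℕ → ℕ} → (∀ j → f j ≡ g j) → ∀ k → neighbourSum f k ≡ neighbourSum g k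
neighbourSum-cong f≗g 0 = f≗g 2
neighbourSum-cong f≗g 1 = f≗g 2
neighbourSum-cong f≗g 2 = cong₂ _+_ (cong₂ _+_ (f≗g 0) (f≗g 1)) (f≗g 3)
neighbourSum-cong f≗g (suc (suc (suc k))) = cong₂ _+_ (f≗g (2 + k)) (f≗g (4 + k))

neighbourSum-*ʳ : ∀ f g k → neighbourSum (λ j → f j * g) k ≡ neighbourSum f k * g
neighbourSum-*ʳ f g 0 = refl
neighbourSum-*ʳ f g 1 = refl
neighbourSum-*ʳ f g 2 = begin
  f 0 * g + f 1 * g + f 3 * g    ≡⟨ cong (_+ f 3 * g) (*-distribʳ-+ g (f 0) (f 1)) ⟨
  (f 0 + f 1) * g + f 3 * g      ≡⟨ *-distribʳ-+ g (f 0 + f 1) (f 3) ⟨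
  (f 0 + f 1 + f 3) * g          ∎
  where open ≡-Reasoning
neighbourSum-*ʳ f g (suc (suc (suc k))) = sym (*-distribʳ-+ g (f (2 + k)) (f (4 + k)))

stem : (ℕ → ℕ) → ℕ → ℕ
stem r zero = r 0 + r 1
stem r (suc k) = r (2 + k)

neighbourSum-stem : ∀ r k → neighbourSum r (2 + k) ≡ stem r k + stem r (2 + k)
neighbourSum-stem r zero = refl
neighbourSum-stem r (suc k) = refl

weightedSum : ∀ {n} → (ℕ → ℕ) → Vec ℕ n → ℕ
weightedSum w [] = 0
weightedSum w (x ∷ v) = w 0 * x + weightedSum (λ j → w (suc j)) v

sum-tabulate-weighted : ∀ {n} (w : ℕ → ℕ) (v : Vec ℕ n) →
  sum (tabulate (λ j → w (toℕ j) * lookup v j)) ≡ weightedSum w v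
sum-tabulate-weighted w [] = refl
sum-tabulate-weighted w (x ∷ v) = cong (w 0 * x +_) (sum-tabulate-weighted (λ j → w (suc j)) v)

weightedSum-cong : ∀ {n} {w w' : ℕ → ℕ} → (∀ j → w j ≡ w' j) → (v : Vec ℕ n) →
  weightedSum w v ≡ weightedSum w' v
weightedSum-cong w≗w' [] = refl
weightedSum-cong w≗w' (x ∷ v) = cong₂ _+_ (cong (_* x) (w≗w' 0)) (weightedSum-cong (λ j → w≗w' (suc j)) v)

weightedSum-+ : ∀ {n} (w w' : ℕ → ℕ) (v : Vec ℕ n) →
  weightedSum (λ j → w j + w' j) v ≡ weightedSum w v + weightedSum w' v
weightedSum-+ w w' [] = refl
weightedSum-+ w w' (x ∷ v) = trans (cong₂ _+_ (*-distribʳ-+ x (w 0) (w' 0)) (weightedSum-+ _ _ v))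
  ([m+n]+[o+p]≡[m+o]+[n+p] (w 0 * x) (w' 0 * x) _ _)

δ : ℕ → ℕ → ℕ
δ p j = if j ≡ᵇ p then 1 else 0

weightedSum-δ : ∀ {n} p (v : Vec ℕ n) → weightedSum (δ p) v ≡ at v p
weightedSum-δ p [] = refl
weightedSum-δ zero (x ∷ v) = trans (cong (1 * x +_) (weightedSum-zero v)) (trans (+-identityʳ _) (*-identityˡ x))
  where
  weightedSum-zero : ∀ {n} (v : Vec ℕ n) → weightedSum (λ _ → 0) v ≡ 0
  weightedSum-zero [] = refl
  weightedSum-zero (_ ∷ v) = weightedSum-zero v
weightedSum-δ (suc p) (x ∷ v) = weightedSum-δ p v

weightedSum-neighbourSum : ∀ {n} (W : ℕ → ℕ → ℕ) k (v : Vec ℕ n) →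
  weightedSum (λ j → neighbourSum (λ p → W p j) k) v ≡ neighbourSum (λ p → weightedSum (W p) v) k
weightedSum-neighbourSum W 0 v = refl
weightedSum-neighbourSum W 1 v = refl
weightedSum-neighbourSum W 2 v = trans (weightedSum-+ (λ j → W 0 j + W 1 j) (W 3) v)
  (cong (_+ weightedSum (W 3) v) (weightedSum-+ (W 0) (W 1) v))
weightedSum-neighbourSum W (suc (suc (suc k))) v = weightedSum-+ (W (2 + k)) (W (4 + k)) v

edge≡neighbourSum-δ : ∀ i j → (if bidentEdge i j then 1 else 0) ≡ neighbourSum (λ p → δ p j) i
edge≡neighbourSum-δ 0 0 = refl
edge≡neighbourSum-δ 0 1 = refl
edge≡neighbourSum-δ 0 2 = refl
edge≡neighbourSum-δ 0 (suc (suc (suc j))) = refl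
edge≡neighbourSum-δ 1 0 = refl
edge≡neighbourSum-δ 1 1 = refl
edge≡neighbourSum-δ 1 2 = refl
edge≡neighbourSum-δ 1 (suc (suc (suc j))) = refl
edge≡neighbourSum-δ 2 0 = refl
edge≡neighbourSum-δ 2 1 = refl
edge≡neighbourSum-δ 2 2 = refl
edge≡neighbourSum-δ 2 3 = refl
edge≡neighbourSum-δ 2 (suc (suc (suc (suc j)))) = refl
edge≡neighbourSum-δ (suc (suc (suc k))) 0 = refl
edge≡neighbourSum-δ (suc (suc (suc k))) 1 = refl
edge≡neighbourSum-δ (suc (suc (suc k))) (suc (suc j)) = path k j
  where
  path : ∀ k j → (if (suc (suc k) ≡ᵇ j) ∨ (j ≡ᵇ k) then 1 else 0) ≡ δ k j + δ (suc (suc k)) j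
  path zero zero = refl
  path (suc k) zero = refl
  path zero (suc zero) = refl
  path zero (suc (suc zero)) = refl
  path zero (suc (suc (suc j))) = refl
  path (suc k) (suc j) = path k j

adjacency-sum : ∀ {n} (i : Fin n) (r : Vec ℕ n) →
  sum (tabulate (λ j → bidentAdj i j * lookup r j)) ≡ neighbourSum (at r) (toℕ i)
adjacency-sum i r = begin
  sum (tabulate (λ j → bidentAdj i j * lookup r j))
    ≡⟨ sum-tabulate-weighted _ r ⟩
  weightedSum (λ j → if bidentEdge (toℕ i) j then 1 else 0) r
    ≡⟨ weightedSum-cong (edge≡neighbourSum-δ (toℕ i)) r ⟩
  weightedSum (λ j → neighbourSum (λ p → δ p j) (toℕ i)) r
    ≡⟨ weightedSum-neighbourSum δ (toℕ i) r ⟩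
  neighbourSum (λ p → weightedSum (δ p) r) (toℕ i)
    ≡⟨ neighbourSum-cong (λ p → weightedSum-δ p r) (toℕ i) ⟩
  neighbourSum (at r) (toℕ i)
    ∎
  where open ≡-Reasoning

lookup≡at : ∀ {n} (v : Vec ℕ n) i → lookup v i ≡ at v (toℕ i)
lookup≡at (x ∷ v) Fin.zero = refl
lookup≡at (x ∷ v) (Fin.suc i) = lookup≡at v i

at-≥ : ∀ {n} (v : Vec ℕ n) k → n ≤ k → at v k ≡ 0
at-≥ [] k _ = refl
at-≥ (x ∷ v) (suc k) (s≤s n≤k) = at-≥ v k n≤k

at-tabulate : ∀ n (h : ℕ → ℕ) → (∀ k → n ≤ k → h k ≡ 0) →
  ∀ k → at (tabulate {n = n} (λ i → h (toℕ i))) k ≡ h k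
at-tabulate zero h vanish k = sym (vanish k z≤n)
at-tabulate (suc n) h vanish zero = refl
at-tabulate (suc n) h vanish (suc k) = at-tabulate n (λ j → h (suc j)) (λ j n≤j → vanish (suc j) (s≤s n≤j)) k

lookup-ext : ∀ {n} {v w : Vec ℕ n} → (∀ i → lookup v i ≡ lookup w i) → v ≡ w
lookup-ext {v = v} {w} v≗w = trans (sym (tabulate∘lookup v)) (trans (tabulate-cong v≗w) (tabulate∘lookup w))

∀Fin⇒∀< : ∀ {n} (P : ℕ → Set) → (∀ (i : Fin n) → P (toℕ i)) → ∀ k → k < n → P k
∀Fin⇒∀< P all k k<n = subst P (toℕ-fromℕ< k<n) (all (fromℕ< k<n))

record SmoothSolution (ℓ : ℕ) (d r : ℕ → ℕ) : Set where
  field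
    laplacian   : ∀ k → k < 3 + ℓ → d k * r k ≡ neighbourSum r k
    d-positive  : ∀ k → k < 3 + ℓ → 0 < d k
    r-positive  : ∀ k → k < 3 + ℓ → 0 < r k
    r-vanishing : ∀ k → 3 + ℓ ≤ k → r k ≡ 0
    smooth      : ∀ k → k < 3 + ℓ → k ≢ 2 → 2 ≤ d k

toSolution : ∀ {ℓ d r} → IsArithStructure (3 + ℓ) d r → IsSmooth (3 + ℓ) d → SmoothSolution ℓ (at d) (at r)
toSolution {ℓ} {d} {r} S smooth = record
  { laplacian   = ∀Fin⇒∀< (λ k → at d k * at r k ≡ neighbourSum (at r) k) λ i →
                    trans (sym (cong₂ _*_ (lookup≡at d i) (lookup≡at r i)))
                          (trans (IsArithStructure.laplacian S i) (adjacency-sum i r))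
  ; d-positive  = ∀Fin⇒∀< (λ k → 0 < at d k) λ i → subst (0 <_) (lookup≡at d i) (IsArithStructure.d-pos S i)
  ; r-positive  = ∀Fin⇒∀< (λ k → 0 < at r k) λ i → subst (0 <_) (lookup≡at r i) (IsArithStructure.r-pos S i)
  ; r-vanishing = at-≥ r
  ; smooth      = ∀Fin⇒∀< (λ k → k ≢ 2 → 2 ≤ at d k) λ i i≢2 →
                    subst (2 ≤_) (lookup≡at d i) (smooth i i≢2)
  }

fromSolution : ∀ {ℓ d r} → SmoothSolution ℓ d r → (∀ p → (∀ k → k < 3 + ℓ → p ∣ r k) → p ≡ 1) →
  IsArithStructure (3 + ℓ) (tabulate (λ i → d (toℕ i))) (tabulate (λ i → r (toℕ i)))
  × IsSmooth (3 + ℓ) (tabulate (λ i → d (toℕ i)))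
fromSolution {ℓ} {d} {r} S r-prim = structure , isSmooth
  where
  open SmoothSolution S
  dV rV : Vec ℕ (3 + ℓ)
  dV = tabulate (λ i → d (toℕ i))
  rV = tabulate (λ i → r (toℕ i))
  lookup-d : ∀ i → lookup dV i ≡ d (toℕ i)
  lookup-d = lookup∘tabulate (λ i → d (toℕ i))
  lookup-r : ∀ i → lookup rV i ≡ r (toℕ i)
  lookup-r = lookup∘tabulate (λ i → r (toℕ i))
  structure : IsArithStructure (3 + ℓ) dV rV
  structure = record
    { d-pos       = λ i → subst (0 <_) (sym (lookup-d i)) (d-positive (toℕ i) (toℕ<n i))
    ; r-pos       = λ i → subst (0 <_) (sym (lookup-r i)) (r-positive (toℕ i) (toℕ<n i))
    ; laplacian   = λ i → trans (cong₂ _*_ (lookup-d i) (lookup-r i))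
        (trans (laplacian (toℕ i) (toℕ<n i))
          (sym (trans (adjacency-sum i rV) (neighbourSum-cong (at-tabulate (3 + ℓ) r r-vanishing) (toℕ i)))))
    ; r-primitive = λ p p∣r → r-prim p (∀Fin⇒∀< (λ k → p ∣ r k) λ i → subst (p ∣_) (lookup-r i) (p∣r i))
    }
  isSmooth : IsSmooth (3 + ℓ) dV
  isSmooth i i≢2 = subst (2 ≤_) (sym (lookup-d i)) (smooth (toℕ i) (toℕ<n i) i≢2)

descend-step : ∀ {m x y z} → 2 ≤ m → m * y ≡ x + z → z < y → y < x
descend-step {m} {x} {y} {z} 2≤m my≡x+z z<y with y <? x
... | yes y<x = y<x
... | no y≮x = ⊥-elim (<⇒≱ (+-mono-≤-< (≮⇒≥ y≮x) z<y) 2y≤x+z)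
  where
  2y≤x+z : y + y ≤ x + z
  2y≤x+z = ≤-trans (≤-reflexive (cong (y +_) (sym (+-identityʳ y))))
                   (≤-trans (*-monoˡ-≤ y 2≤m) (≤-reflexive my≡x+z))

-- Going down from the first zero, m ≥ 2 makes s strictly decreasing, so s (2 + k) is the least
-- residue of -(s k) modulo s (1 + k).
convex⇒residues : ∀ ℓ (s m : ℕ → ℕ) →
  (∀ k → k ≤ ℓ → m k * s (suc k) ≡ s k + s (2 + k)) → (∀ k → k < ℓ → 2 ≤ m (suc k)) →
  0 < s (suc ℓ) → (∀ k → 2 + ℓ ≤ k → s k ≡ 0) →
  ∀ k → s k ≡ residues (s 0) (s 1) k
convex⇒residues ℓ s m recurrence convex last-positive vanishing = residues-unique s step
  where
  descending : ∀ i j → i + j ≡ ℓ → s (2 + j) < s (suc j)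
  descending zero j refl = subst (_< s (suc j)) (sym (vanishing (2 + j) ≤-refl)) last-positive
  descending (suc i) j i+j≡ℓ = descend-step (convex j j<ℓ) (recurrence (suc j) j<ℓ)
    (descending i (suc j) (trans (+-suc i j) i+j≡ℓ))
    where
    j<ℓ : j < ℓ
    j<ℓ = subst (j <_) i+j≡ℓ (m<n+m j z<s)
  step : ∀ k → s (2 + k) ≡ negMod (s k) (s (suc k))
  step k with k ≤? ℓ
  ... | yes k≤ℓ = negMod-unique (s k) (descending (ℓ ∸ k) k (m∸n+n≡m k≤ℓ))
                    (divides (m k) (sym (recurrence k k≤ℓ)))
  ... | no k≰ℓ rewrite vanishing (2 + k) (m≤n⇒m≤1+n (s≤s (≰⇒> k≰ℓ)))
                     | vanishing (suc k) (s≤s (≰⇒> k≰ℓ)) = refl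

stem-residues : ∀ {ℓ d r} → SmoothSolution ℓ d r → ∀ k → stem r k ≡ residues (stem r 0) (stem r 1) k
stem-residues {ℓ} {d} {r} S = convex⇒residues ℓ (stem r) (λ k → d (2 + k))
  (λ k k≤ℓ → trans (laplacian (2 + k) (s≤s (s≤s (s≤s k≤ℓ)))) (neighbourSum-stem r k))
  (λ k k<ℓ → smooth (3 + k) (s≤s (s≤s (s≤s k<ℓ))) λ ())
  (r-positive (2 + ℓ) ≤-refl)
  (λ { (suc k) 2+ℓ≤1+k → r-vanishing (2 + k) (s≤s 2+ℓ≤1+k) })
  where open SmoothSolution S

rbar : ℕ → ℕ → ℕ → ℕ
rbar a b 0 = a
rbar a b 1 = b
rbar a b (suc (suc k)) = residues (a + b) (a * b) (suc k)

solution-proportional : ∀ {ℓ d r} a b → SmoothSolution ℓ d r → r 2 ≡ b * r 0 → r 2 ≡ a * r 1 →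
  ∀ v → a * b * r v ≡ r 2 * rbar a b v
solution-proportional {r = r} a b S r₂≡br₀ r₂≡ar₁ 0 = begin
  a * b * r 0    ≡⟨ *-assoc a b (r 0) ⟩
  a * (b * r 0)  ≡⟨ cong (a *_) r₂≡br₀ ⟨
  a * r 2        ≡⟨ *-comm a (r 2) ⟩
  r 2 * a        ∎
  where open ≡-Reasoning
solution-proportional {r = r} a b S r₂≡br₀ r₂≡ar₁ 1 = begin
  a * b * r 1    ≡⟨ m*n*o≡n*[m*o] a b (r 1) ⟩
  b * (a * r 1)  ≡⟨ cong (b *_) r₂≡ar₁ ⟨
  b * r 2        ≡⟨ *-comm b (r 2) ⟩
  r 2 * b        ∎
  where open ≡-Reasoning
solution-proportional {r = r} a b S r₂≡br₀ r₂≡ar₁ (suc (suc k)) = begin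
  a * b * r (2 + k)                                   ≡⟨ cong (a * b *_) (stem-residues S (suc k)) ⟩
  a * b * residues (r 0 + r 1) (r 2) (suc k)          ≡⟨ residues-* (a * b) (r 0 + r 1) (r 2) (suc k) ⟩
  residues (a * b * (r 0 + r 1)) (a * b * r 2) (suc k) ≡⟨ cong₂ (λ x y → residues x y (suc k))
                                                            ab[r₀+r₁]≡ (*-comm (a * b) (r 2)) ⟩
  residues (r 2 * (a + b)) (r 2 * (a * b)) (suc k)    ≡⟨ residues-* (r 2) (a + b) (a * b) (suc k) ⟨
  r 2 * residues (a + b) (a * b) (suc k)              ∎
  where
  open ≡-Reasoning
  ab[r₀+r₁]≡ : a * b * (r 0 + r 1) ≡ r 2 * (a + b)
  ab[r₀+r₁]≡ = begin
    a * b * (r 0 + r 1)           ≡⟨ *-distribˡ-+ (a * b) (r 0) (r 1) ⟩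
    a * b * r 0 + a * b * r 1     ≡⟨ cong₂ _+_ (*-assoc a b (r 0)) (m*n*o≡n*[m*o] a b (r 1)) ⟩
    a * (b * r 0) + b * (a * r 1) ≡⟨ cong₂ (λ x y → a * x + b * y) r₂≡br₀ r₂≡ar₁ ⟨
    a * r 2 + b * r 2             ≡⟨ *-distribʳ-+ (r 2) a b ⟨
    (a + b) * r 2                 ≡⟨ *-comm (a + b) (r 2) ⟩
    r 2 * (a + b)                 ∎

RbarAt-x⇒ : ∀ {n} (r : Vec ℕ n) a → 0 < at r 0 → RbarAt r 0 a → at r 2 ≡ a * at r 1
RbarAt-x⇒ r a 0<r₀ rbar-x =
  *-cancelʳ-≡ _ _ (at r 0) {{>-nonZero 0<r₀}} (trans rbar-x (m*[n*o]≡m*o*n a (at r 0) (at r 1)))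

RbarAt-y⇒ : ∀ {n} (r : Vec ℕ n) b → 0 < at r 1 → RbarAt r 1 b → at r 2 ≡ b * at r 0
RbarAt-y⇒ r b 0<r₁ rbar-y =
  *-cancelʳ-≡ _ _ (at r 1) {{>-nonZero 0<r₁}} (trans rbar-y (sym (*-assoc b (at r 0) (at r 1))))

structure-proportional : ∀ {ℓ} a b {d r} → SmoothStructWith (3 + ℓ) a b d r →
  ∀ v → a * b * at r v ≡ at r 2 * rbar a b v
structure-proportional {ℓ} a b {d} {r} (S , smooth , rbar-x , rbar-y) =
  solution-proportional a b solution
    (RbarAt-y⇒ r b (r-positive 1 (s≤s z<s)) rbar-y) (RbarAt-x⇒ r a (r-positive 0 z<s) rbar-x)
  where
  solution : SmoothSolution ℓ (at d) (at r)
  solution = toSolution S smooth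
  open SmoothSolution solution

structure⇒positiveTerms : ∀ {ℓ a b d r} → 0 < a → 0 < b → SmoothStructWith (3 + ℓ) a b d r →
  positiveTerms (a + b) (a * b) ≡ suc ℓ
structure⇒positiveTerms {ℓ} {a} {b} {d} {r} 0<a 0<b 𝒮@(S , smooth , _) =
  positiveTerms-exact (suc ℓ) (a + b) (a * b) (positive , vanishing)
  where
  open SmoothSolution (toSolution S smooth)
  positive : ∀ j → j < suc ℓ → 0 < rbar a b (2 + j)
  positive j j<1+ℓ = positive-factorʳ (at r 2) (subst (0 <_) (structure-proportional a b 𝒮 (2 + j))
    (*-positive (*-positive 0<a 0<b) (r-positive (2 + j) (s≤s (s≤s j<1+ℓ)))))
  vanishing : rbar a b (3 + ℓ) ≡ 0
  vanishing = *-cancelˡ-≡ _ 0 (at r 2) {{>-nonZero (r-positive 2 (s≤s (s≤s z<s)))}} (begin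
    at r 2 * rbar a b (3 + ℓ)  ≡⟨ structure-proportional a b 𝒮 (3 + ℓ) ⟨
    a * b * at r (3 + ℓ)       ≡⟨ cong (a * b *_) (r-vanishing (3 + ℓ) ≤-refl) ⟩
    a * b * 0                  ≡⟨ *-zeroʳ (a * b) ⟩
    0                          ≡⟨ *-zeroʳ (at r 2) ⟨
    at r 2 * 0                 ∎)
    where open ≡-Reasoning

Primitive : ∀ {I : Set} → (I → ℕ) → Set
Primitive u = ∀ p → (∀ i → p ∣ u i) → p ≡ 1

primitive-proportional⇒≡ : ∀ {I : Set} (u v : I → ℕ) {x y} → 0 < x → (∀ i → x * u i ≡ y * v i) →
  Primitive u → Primitive v → ∀ i → u i ≡ v i
primitive-proportional⇒≡ u v {x} {y} 0<x xu≡yv u-prim v-prim i =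
  *-cancelˡ-≡ (u i) (v i) x {{>-nonZero 0<x}} (trans (xu≡yv i) (cong (_* v i) (sym x≡y)))
  where
  h : ℕ
  h = gcd x y
  instance
    h≢0 : NonZero h
    h≢0 = ≢-nonZero (gcd[m,n]≢0 x y (inj₁ (≢-nonZero⁻¹ x {{>-nonZero 0<x}})))
  x′h≡x : x / h * h ≡ x
  x′h≡x = m/n*n≡m (gcd[m,n]∣m x y)
  y′h≡y : y / h * h ≡ y
  y′h≡y = m/n*n≡m (gcd[m,n]∣n x y)
  x′u≡y′v : ∀ i → x / h * u i ≡ y / h * v i
  x′u≡y′v i = *-cancelʳ-≡ _ _ h (begin
    x / h * u i * h    ≡⟨ m*n*o≡m*o*n (x / h) (u i) h ⟩
    x / h * h * u i    ≡⟨ cong (_* u i) x′h≡x ⟩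
    x * u i            ≡⟨ xu≡yv i ⟩
    y * v i            ≡⟨ cong (_* v i) y′h≡y ⟨
    y / h * h * v i    ≡⟨ m*n*o≡m*o*n (y / h) h (v i) ⟩
    y / h * v i * h    ∎)
    where open ≡-Reasoning
  x/h≡1 : x / h ≡ 1
  x/h≡1 = v-prim (x / h) λ i → coprime-divisor (coprime-/gcd x y)
    (divides (u i) (trans (sym (x′u≡y′v i)) (*-comm (x / h) (u i))))
  y/h≡1 : y / h ≡ 1
  y/h≡1 = u-prim (y / h) λ i → coprime-divisor (Coprime.sym (coprime-/gcd x y))
    (divides (v i) (trans (x′u≡y′v i) (*-comm (y / h) (v i))))
  x≡y : x ≡ y
  x≡y = trans (sym x′h≡x) (trans (cong (_* h) (trans x/h≡1 (sym y/h≡1))) y′h≡y)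

cross-proportional : ∀ {x y y' u u' c} → 0 < x → x * u ≡ y * c → x * u' ≡ y' * c → y * u' ≡ y' * u
cross-proportional {x} {y} {y'} {u} {u'} {c} 0<x xu≡yc xu'≡y'c = *-cancelˡ-≡ _ _ x {{>-nonZero 0<x}} (begin
  x * (y * u')   ≡⟨ m*[n*o]≡n*[m*o] x y u' ⟩
  y * (x * u')   ≡⟨ cong (y *_) xu'≡y'c ⟩
  y * (y' * c)   ≡⟨ m*[n*o]≡n*[m*o] y y' c ⟩
  y' * (y * c)   ≡⟨ cong (y' *_) xu≡yc ⟨
  y' * (x * u)   ≡⟨ m*[n*o]≡n*[m*o] y' x u ⟩
  x * (y' * u)   ∎)
  where open ≡-Reasoning

laplacian-determines-d : ∀ {n d d' r} → IsArithStructure n d r → IsArithStructure n d' r → d' ≡ d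
laplacian-determines-d {r = r} S S' = lookup-ext λ i →
  *-cancelʳ-≡ _ _ (lookup r i) {{>-nonZero (IsArithStructure.r-pos S i)}}
    (trans (IsArithStructure.laplacian S' i) (sym (IsArithStructure.laplacian S i)))

structure-unique : ∀ {ℓ} a b {d r d' r'} → 0 < a → 0 < b →
  SmoothStructWith (3 + ℓ) a b d r → SmoothStructWith (3 + ℓ) a b d' r' → d' ≡ d × r' ≡ r
structure-unique {ℓ} a b {d} {r} {d'} {r'} 0<a 0<b 𝒮@(S , smooth , _) 𝒮'@(S' , _) =
  laplacian-determines-d S (subst (IsArithStructure (3 + ℓ) d') r'≡r S') , r'≡r
  where
  proportional : ∀ k → at r 2 * at r' k ≡ at r' 2 * at r k
  proportional k = cross-proportional {y = at r 2} {at r' 2} {c = rbar a b k} (*-positive 0<a 0<b)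
    (structure-proportional a b 𝒮 k) (structure-proportional a b 𝒮' k)
  r'≡r : r' ≡ r
  r'≡r = lookup-ext (primitive-proportional⇒≡ (lookup r') (lookup r) {y = at r' 2}
    (SmoothSolution.r-positive (toSolution S smooth) 2 (s≤s (s≤s z<s)))
    (λ i → subst₂ (λ u u' → at r 2 * u' ≡ at r' 2 * u) (sym (lookup≡at r i)) (sym (lookup≡at r' i))
             (proportional (toℕ i)))
    (IsArithStructure.r-primitive S') (IsArithStructure.r-primitive S))

⌈_/_⌉ : ℕ → ℕ → ℕ
⌈ x / zero ⌉ = 0
⌈ x / m@(suc _) ⌉ = (x + negMod x m) / m

⌈/⌉-* : ∀ x {m} → 0 < m → ⌈ x / m ⌉ * m ≡ x + negMod x m
⌈/⌉-* x {suc _} 0<m = m/n*n≡m (negMod-∣ x 0<m)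

⌈/⌉-positive : ∀ {x m} → 0 < x → 0 < m → 0 < ⌈ x / m ⌉
⌈/⌉-positive {x} {m} 0<x 0<m with ⌈ x / m ⌉ in eq
... | zero = ⊥-elim (<⇒≢ (<-≤-trans 0<x (m≤m+n x _)) (sym (trans (sym (⌈/⌉-* x 0<m)) (cong (_* m) eq))))
... | suc _ = z<s

⌈/⌉-≥2 : ∀ {x m} → 0 < m → m < x → 2 ≤ ⌈ x / m ⌉
⌈/⌉-≥2 {x} {m} 0<m m<x = *-cancelʳ-< m 1 ⌈ x / m ⌉
  (subst (m + 0 <_) (sym (⌈/⌉-* x 0<m)) (<-≤-trans (subst (_< x) (sym (+-identityʳ m)) m<x) (m≤m+n x _)))

dbar : ℕ → ℕ → ℕ → ℕ
dbar a b 0 = b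
dbar a b 1 = a
dbar a b (suc (suc k)) = ⌈ residues (a + b) (a * b) k / residues (a + b) (a * b) (suc k) ⌉

stem-rbar : ∀ a b k → stem (rbar a b) k ≡ residues (a + b) (a * b) k
stem-rbar a b zero = refl
stem-rbar a b (suc k) = refl

rbar-solution : ∀ {ℓ a b} → 2 ≤ a → 2 ≤ b → positiveTerms (a + b) (a * b) ≡ suc ℓ →
  SmoothSolution ℓ (dbar a b) (rbar a b)
rbar-solution {ℓ} {a} {b} 2≤a 2≤b count = record
  { laplacian   = laplacian
  ; d-positive  = d-positive
  ; r-positive  = λ k k<3+ℓ → r-positive k (≤-pred k<3+ℓ)
  ; r-vanishing = r-vanishing
  ; smooth      = smooth
  }
  where
  s : ℕ → ℕ
  s = residues (a + b) (a * b)
  terms : HasPositiveTerms (a + b) (a * b) (suc ℓ)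
  terms = subst (HasPositiveTerms (a + b) (a * b)) count (hasPositiveTerms (a * b) (a + b))
  s-positive : ∀ j → j ≤ suc ℓ → 0 < s j
  s-positive zero _ = <-≤-trans z<s (≤-trans 2≤a (m≤m+n a b))
  s-positive (suc j) j<1+ℓ = proj₁ terms j j<1+ℓ
  r-positive : ∀ k → k ≤ 2 + ℓ → 0 < rbar a b k
  r-positive 0 _ = <-≤-trans z<s 2≤a
  r-positive 1 _ = <-≤-trans z<s 2≤b
  r-positive (suc (suc j)) (s≤s (s≤s j≤ℓ)) = s-positive (suc j) (s≤s j≤ℓ)
  laplacian : ∀ k → k < 3 + ℓ → dbar a b k * rbar a b k ≡ neighbourSum (rbar a b) k
  laplacian 0 _ = *-comm b a
  laplacian 1 _ = refl
  laplacian (suc (suc k)) (s≤s (s≤s (s≤s k≤ℓ))) = begin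
    ⌈ s k / s (suc k) ⌉ * s (suc k)   ≡⟨ ⌈/⌉-* (s k) (s-positive (suc k) (s≤s k≤ℓ)) ⟩
    s k + negMod (s k) (s (suc k))    ≡⟨ cong (s k +_) (residues-suc-suc (a + b) (a * b) k) ⟨
    s k + s (2 + k)                   ≡⟨ cong (_+ s (2 + k)) (stem-rbar a b k) ⟨
    stem (rbar a b) k + s (2 + k)     ≡⟨ neighbourSum-stem (rbar a b) k ⟨
    neighbourSum (rbar a b) (2 + k)   ∎
    where open ≡-Reasoning
  d-positive : ∀ k → k < 3 + ℓ → 0 < dbar a b k
  d-positive 0 _ = <-≤-trans z<s 2≤b
  d-positive 1 _ = <-≤-trans z<s 2≤a
  d-positive (suc (suc k)) (s≤s (s≤s (s≤s k≤ℓ))) =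
    ⌈/⌉-positive (s-positive k (m≤n⇒m≤1+n k≤ℓ)) (s-positive (suc k) (s≤s k≤ℓ))
  r-vanishing : ∀ k → 3 + ℓ ≤ k → rbar a b k ≡ 0
  r-vanishing (suc (suc j)) (s≤s (s≤s 1+ℓ≤j)) = residues-≡0 (a + b) (a * b) (≤⇒≤′ 1+ℓ≤j) (proj₂ terms)
  smooth : ∀ k → k < 3 + ℓ → k ≢ 2 → 2 ≤ dbar a b k
  smooth 0 _ _ = 2≤b
  smooth 1 _ _ = 2≤a
  smooth 2 _ 2≢2 = ⊥-elim (2≢2 refl)
  smooth (suc (suc (suc j))) (s≤s (s≤s (s≤s j<ℓ))) _ =
    ⌈/⌉-≥2 (s-positive (2 + j) (s≤s j<ℓ)) (residues-< (a + b) (a * b) j (s-positive (suc j) (s≤s (<⇒≤ j<ℓ))))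

gcdUpTo : (ℕ → ℕ) → ℕ → ℕ
gcdUpTo f zero = 0
gcdUpTo f (suc m) = gcd (gcdUpTo f m) (f m)

gcdUpTo-∣ : ∀ f {m k} → k < m → gcdUpTo f m ∣ f k
gcdUpTo-∣ f {suc m} {k} k<1+m with k ≟ m
... | yes refl = gcd[m,n]∣n (gcdUpTo f m) (f m)
... | no k≢m = ∣-trans (gcd[m,n]∣m (gcdUpTo f m) (f m)) (gcdUpTo-∣ f (≤∧≢⇒< (≤-pred k<1+m) k≢m))

gcdUpTo-greatest : ∀ f {m p} → (∀ k → k < m → p ∣ f k) → p ∣ gcdUpTo f m
gcdUpTo-greatest f {zero} _ = _ ∣0
gcdUpTo-greatest f {suc m} p∣f = gcd-greatest (gcdUpTo-greatest f (λ k k<m → p∣f k (m<n⇒m<1+n k<m))) (p∣f m ≤-refl)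

solution-÷ : ∀ {ℓ d c r g} → 0 < g → (∀ k → r k * g ≡ c k) → SmoothSolution ℓ d c → SmoothSolution ℓ d r
solution-÷ {ℓ} {d} {c} {r} {g} 0<g rg≡c S = record
  { laplacian   = λ k k<n → *-cancelʳ-≡ _ _ g {{>-nonZero 0<g}} (begin
      d k * r k * g                       ≡⟨ *-assoc (d k) (r k) g ⟩
      d k * (r k * g)                     ≡⟨ cong (d k *_) (rg≡c k) ⟩
      d k * c k                           ≡⟨ laplacian k k<n ⟩
      neighbourSum c k                    ≡⟨ neighbourSum-cong rg≡c k ⟨
      neighbourSum (λ j → r j * g) k      ≡⟨ neighbourSum-*ʳ r g k ⟩
      neighbourSum r k * g                ∎)
  ; d-positive  = d-positive
  ; r-positive  = λ k k<n → positive-factorʳ g (subst (0 <_) (trans (sym (rg≡c k)) (*-comm (r k) g)) (r-positive k k<n))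
  ; r-vanishing = λ k n≤k → *-cancelʳ-≡ (r k) 0 g {{>-nonZero 0<g}} (trans (rg≡c k) (r-vanishing k n≤k))
  ; smooth      = smooth
  }
  where
  open SmoothSolution S
  open ≡-Reasoning

primitivePart : ∀ {ℓ d c} → SmoothSolution ℓ d c →
  Σ (Vec ℕ (3 + ℓ) × Vec ℕ (3 + ℓ)) λ { (dV , rV) →
    IsArithStructure (3 + ℓ) dV rV × IsSmooth (3 + ℓ) dV × Σ ℕ λ g → 0 < g × (∀ k → at rV k * g ≡ c k) }
primitivePart {ℓ} {d} {c} S =
  (tabulate (λ i → d (toℕ i)) , tabulate (λ i → r (toℕ i))) ,
  proj₁ structure , proj₂ structure ,
  g , 0<g , λ k → trans (cong (_* g) (at-tabulate (3 + ℓ) r (SmoothSolution.r-vanishing solution) k)) (rg≡c k)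
  where
  open SmoothSolution S
  g : ℕ
  g = gcdUpTo c (3 + ℓ)
  g∣c : ∀ k → g ∣ c k
  g∣c k with k <? 3 + ℓ
  ... | yes k<n = gcdUpTo-∣ c k<n
  ... | no k≮n = subst (g ∣_) (sym (r-vanishing k (≮⇒≥ k≮n))) (g ∣0)
  0<g : 0 < g
  0<g = n≢0⇒n>0 λ g≡0 → <⇒≢ (r-positive 0 z<s) (sym (0∣⇒≡0 (subst (_∣ c 0) g≡0 (g∣c 0))))
  r : ℕ → ℕ
  r k = _∣_.quotient (g∣c k)
  rg≡c : ∀ k → r k * g ≡ c k
  rg≡c k = sym (_∣_.equality (g∣c k))
  solution : SmoothSolution ℓ d r
  solution = solution-÷ 0<g rg≡c S
  r-primitive : ∀ p → (∀ k → k < 3 + ℓ → p ∣ r k) → p ≡ 1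
  r-primitive p p∣r = ∣1⇒≡1 (*-cancelʳ-∣ g {{>-nonZero 0<g}} (subst (p * g ∣_) (sym (*-identityˡ g))
    (gcdUpTo-greatest c λ k k<n → subst (p * g ∣_) (rg≡c k) (*-monoˡ-∣ g (p∣r k k<n)))))
  structure : IsArithStructure (3 + ℓ) (tabulate (λ i → d (toℕ i))) (tabulate (λ i → r (toℕ i)))
              × IsSmooth (3 + ℓ) (tabulate (λ i → d (toℕ i)))
  structure = fromSolution solution r-primitive

RbarAt-÷ : ∀ {n} (r : Vec ℕ n) (c : ℕ → ℕ) {g} v x → 0 < g → (∀ k → at r k * g ≡ c k) →
  c 2 * c v ≡ x * (c 0 * c 1) → RbarAt r v x
RbarAt-÷ r c {g} v x 0<g rg≡c c₂cᵥ≡ = *-cancelʳ-≡ _ _ (g * g) {{>-nonZero (*-positive 0<g 0<g)}} (begin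
  at r 2 * at r v * (g * g)          ≡⟨ [m*n]*[o*p]≡[m*o]*[n*p] (at r 2) (at r v) g g ⟩
  (at r 2 * g) * (at r v * g)        ≡⟨ cong₂ _*_ (rg≡c 2) (rg≡c v) ⟩
  c 2 * c v                          ≡⟨ c₂cᵥ≡ ⟩
  x * (c 0 * c 1)                    ≡⟨ cong (x *_) (cong₂ _*_ (rg≡c 0) (rg≡c 1)) ⟨
  x * ((at r 0 * g) * (at r 1 * g))  ≡⟨ cong (x *_) ([m*n]*[o*p]≡[m*o]*[n*p] (at r 0) g (at r 1) g) ⟩
  x * ((at r 0 * at r 1) * (g * g))  ≡⟨ *-assoc x _ (g * g) ⟨
  x * (at r 0 * at r 1) * (g * g)    ∎)
  where open ≡-Reasoning

structure-exists : ∀ {ℓ} a b → 2 ≤ a → 2 ≤ b → positiveTerms (a + b) (a * b) ≡ suc ℓ →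
  Σ (Vec ℕ (3 + ℓ) × Vec ℕ (3 + ℓ)) λ { (d , r) → SmoothStructWith (3 + ℓ) a b d r }
structure-exists a b 2≤a 2≤b count with primitivePart (rbar-solution 2≤a 2≤b count)
... | (d , r) , S , smooth , g , 0<g , rg≡c =
  (d , r) , S , smooth ,
  RbarAt-÷ r (rbar a b) 0 a 0<g rg≡c (*-comm (a * b) a) ,
  RbarAt-÷ r (rbar a b) 1 b 0<g rg≡c (*-comm (a * b) b)

theorem3p3 : (a b : ℕ) → 2 ≤ a → 2 ≤ b →
    (t ε : ℕ) → a + b ≡ t * (b * b) + ε → ε < b * b →
    (q : ℕ) → q * (a + b) ≤ a * b → a * b < suc q * (a + b) →
    (n : ℕ) → 3 ≤ n →
    (n ≡ F (b * b) ε + t + q →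
      Σ (Vec ℕ n × Vec ℕ n) (λ { (d , r) → SmoothStructWith n a b d r ×
        ((d' r' : Vec ℕ n) → SmoothStructWith n a b d' r' → (d' ≡ d × r' ≡ r)) }))
    × (n ≢ F (b * b) ε + t + q →
      (d r : Vec ℕ n) → ¬ SmoothStructWith n a b d r)
theorem3p3 a b 2≤a 2≤b t ε a+b≡ _ q q[a+b]≤ab ab<[1+q][a+b] (suc (suc (suc ℓ))) (s≤s (s≤s (s≤s _))) =
  (λ n≡F → let (dr , 𝒮) = structure-exists a b 2≤a 2≤b (sym (suc-injective (suc-injective (trans n≡F count))))
           in dr , 𝒮 , λ _ _ → structure-unique a b 0<a 0<b 𝒮) ,
  (λ n≢F _ _ 𝒮 → n≢F (trans (cong (2 +_) (sym (structure⇒positiveTerms 0<a 0<b 𝒮))) (sym count)))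
  where
  0<a : 0 < a
  0<a = <-≤-trans z<s 2≤a
  0<b : 0 < b
  0<b = <-≤-trans z<s 2≤b
  count : F (b * b) ε + t + q ≡ 2 + positiveTerms (a + b) (a * b)
  count = F-bident a b t ε q 0<b a+b≡ q[a+b]≤ab ab<[1+q][a+b]
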